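{- Let $\epsilon=(\epsilon_1,\dots,\epsilon_s)$ be a circular sequence with $\epsilon_i\in\{1,-1\}$ for all $i$. For every integer $\lambda\ge2$, $a_\lambda(\epsilon)\le a_{\lambda-1}(\epsilon)$.
   Context: Indices are taken modulo $s$. For $\lambda\ge1$, a free linear segment of level $\lambda$ is a run of consecutive entries $\epsilon_a,\epsilon_{a+1},\dots,\epsilon_b$ ($a\in\{1,\dots,s\}$, $a\le b$, indices mod $s$) such that $\epsilon_a=-1$, $\epsilon_b=1$, $\sum_{j=a}^b\epsilon_j=0$, $-\lambda\le\sum_{j=a}^i\epsilon_j<0$ for all $a\le i<b$, and $\sum_{j=a}^{i_1}\epsilon_j=-\lambda$ for some $a\le i_1<b$. $a_\lambda(\epsilon)$ is the number of free linear segments of level $\lambda$ in $\epsilon$. -}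

module Defs where

open import Data.Nat as ℕ using (ℕ; zero; suc; NonZero)
open import Data.Nat.DivMod using (_mod_)
open import Data.Fin using (Fin; toℕ)
open import Data.Fin.Properties using (all?; any?)
open import Data.Integer as ℤ using (ℤ; +_; -_; _≤_; _<_; _≟_; _≤?_; _<?_)
open import Data.Product using (_×_; ∃)
open import Data.List using (List; map)
open import Data.Nat.ListAction using (sum)
open import Data.List.Base using (allFin)
open import Relation.Binary.PropositionalEquality using (_≡_)
open import Relation.Nullary using (Dec; yes; no)
open import Relation.Nullary.Decidable using (_×-dec_)

-- A circular ±1 sequence of length s (entries ε_1..ε_s are stored at Fin s,
-- i.e. 0-based; the circular index k (any natural) refers to entry k mod s).
IsPMOne : ∀ {s} → (Fin s → ℤ) → Set
IsPMOne ε = ∀ i → (ε i ≡ + 1) Data.Sum.⊎ (ε i ≡ - (+ 1))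
  where import Data.Sum

entry : (s : ℕ) .{{_ : NonZero s}} → (Fin s → ℤ) → ℕ → ℤ
entry s ε k = ε (k mod s)

psum : (ℕ → ℤ) → ℕ → ℕ → ℤ
psum e a zero = e a
psum e a (suc i) = psum e a i ℤ.+ e (a ℕ.+ suc i)

IsFreeSeg : ℕ → (ℕ → ℤ) → ℕ → ℕ → Set
IsFreeSeg λ′ e a m =
  (e a ≡ - (+ 1)) ×
  (e (a ℕ.+ m) ≡ + 1) ×
  (psum e a m ≡ + 0) ×
  (∀ (i : Fin m) → (- (+ λ′) ≤ psum e a (toℕ i)) × (psum e a (toℕ i) < + 0)) ×
  ∃ (λ (i : Fin m) → psum e a (toℕ i) ≡ - (+ λ′))

isFreeSeg? : ∀ λ′ e a m → Dec (IsFreeSeg λ′ e a m)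
isFreeSeg? λ′ e a m =
  (e a ≟ - (+ 1)) ×-dec
  (e (a ℕ.+ m) ≟ + 1) ×-dec
  (psum e a m ≟ + 0) ×-dec
  all? (λ i → (- (+ λ′) ≤? psum e a (toℕ i)) ×-dec (psum e a (toℕ i) <? + 0)) ×-dec
  any? (λ i → psum e a (toℕ i) ≟ - (+ λ′))

count : ∀ {P : Set} → Dec P → ℕ
count (yes _) = 1
count (no _) = 0

-- a_λ(ε): number of pairs (a, b) with a ∈ {1..s} (as Fin s) and b = a + m,
-- m < s, forming a free linear segment of level λ. (Segments have length ≤ s
-- automatically.)
a[_] : ℕ → (s : ℕ) .{{_ : NonZero s}} → (Fin s → ℤ) → ℕ
a[ λ′ ] s ε =
  sum (map (λ (a : Fin s) → sum (map (λ (m : Fin s) →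
        count (isFreeSeg? λ′ (entry s ε) (toℕ a) (toℕ m))) (allFin s))) (allFin s))

-- Read the sequence as a walk: psum e a i is the height reached after the
-- steps ε_a, …, ε_{a+i}.  A free segment of level λ+1 starting at a is an
-- excursion below 0 that reaches depth -(λ+1).  Let I be a time where it does,
-- and t the last time ≤ I at which the walk sits at -1.  The sub-excursion that
-- starts at b = a+t+1 and ends at the first return to -1 is a free segment of
-- level λ starting at b (lemmas lastAnchor, excursion, descend).  Call b a
-- "child" of a.  A position b is the child of at most one a: if two walks from
-- a and a' both descend to b, the longer one passes position a (modulo s) and
-- then repeats the shorter one, so it was at height 0 just before, which an
-- anchored walk never is (anchor-no-reentry, childOf-functional); this is where
-- circularity is used.  Since at most one free segment starts at each
-- position, the inequality then follows from a general counting principle on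
-- finite sums: a 0/1-valued count is dominated by any count into which it maps
-- through an injective relation (injectiveCount).
module Submission where

open import Defs
open import Data.Nat using (ℕ; NonZero; _≤_; _∸_)
open import Data.Fin using (Fin)
open import Data.Integer using (ℤ)

open import Data.Nat using (zero; suc; _+_; _*_; _%_; _<_; z≤n; s≤s)
import Data.Nat.Properties as ℕP
open import Data.Nat.DivMod using (_mod_; %-distribˡ-+; m%n%n≡m%n; [m+kn]%n≡m%n; m<n⇒m%n≡m; m%n<n)
open import Data.Integer using (+_; -[1+_]; -_; 0ℤ; 1ℤ; -1ℤ; -≤-; -≤+; +≤+; -<+; +<+)
  renaming (_+_ to _+ℤ_; _≤_ to _≤ℤ_; _<_ to _<ℤ_)
import Data.Integer as ℤ
import Data.Integer.Properties as ℤP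
open import Data.Fin using (zero; suc; toℕ; fromℕ<; _≟_)
open import Data.Fin.Properties using (toℕ-fromℕ<; toℕ<n; toℕ-injective; suc-injective; 0≢1+n; all?; any?)
open import Data.List using (tabulate; map)
open import Data.List.Base using (allFin)
open import Data.List.Properties using (map-tabulate)
import Data.Nat.ListAction as List
open import Algebra.Properties.CommutativeMonoid.Sum ℕP.+-0-commutativeMonoid
  using (sum-syntax; ∑-comm; sum-cong-≗; sum-replicate-zero) renaming (sum to ∑)
open import Algebra.Properties.Semiring.Sum ℕP.+-*-semiring using (*-distribʳ-sum)
open import Data.Sum using (_⊎_; inj₁; inj₂)
open import Data.Product using (_×_; _,_; proj₁; proj₂; ∃)
open import Data.Empty using (⊥-elim)
open import Function using (_∘_)
open import Relation.Nullary using (Dec; yes; no; ¬_)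
open import Relation.Nullary.Decidable using (_×-dec_)
open import Relation.Binary.PropositionalEquality using (_≡_; _≢_; refl; sym; trans; cong; cong₂; subst; subst₂; module ≡-Reasoning)
open import Relation.Binary using (tri<; tri≈; tri>)

count-true : ∀ {P : Set} (d : Dec P) → P → count d ≡ 1
count-true (yes _) _ = refl
count-true (no ¬p) p = ⊥-elim (¬p p)

count-false : ∀ {P : Set} (d : Dec P) → ¬ P → count d ≡ 0
count-false (yes p) ¬p = ⊥-elim (¬p p)
count-false (no _) _ = refl

count-pos : ∀ {P : Set} (d : Dec P) → 0 < count d → P
count-pos (yes p) _ = p

listSum-allFin : ∀ {n} (f : Fin n → ℕ) → List.sum (map f (allFin n)) ≡ ∑ f
listSum-allFin f = trans (cong List.sum (map-tabulate (λ i → i) f)) (listSum-tabulate f)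
  where
  listSum-tabulate : ∀ {n} (g : Fin n → ℕ) → List.sum (tabulate g) ≡ ∑ g
  listSum-tabulate {zero} g = refl
  listSum-tabulate {suc n} g = cong (λ rest → g zero + rest) (listSum-tabulate (g ∘ suc))

∑-mono : ∀ {n} {f g : Fin n → ℕ} → (∀ i → f i ≤ g i) → ∑ f ≤ ∑ g
∑-mono {zero} _ = z≤n
∑-mono {suc n} f≤g = ℕP.+-mono-≤ (f≤g zero) (∑-mono (f≤g ∘ suc))

term≤∑ : ∀ {n} (f : Fin n → ℕ) i → f i ≤ ∑ f
term≤∑ f zero = ℕP.m≤m+n _ _
term≤∑ f (suc i) = ℕP.≤-trans (term≤∑ (f ∘ suc) i) (ℕP.m≤n+m _ (f zero))

∑-pos : ∀ {n} (f : Fin n → ℕ) → 0 < ∑ f → ∃ λ i → 0 < f i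
∑-pos {suc n} f pos with f zero in f0
... | suc _ = zero , subst (0 <_) (sym f0) (s≤s z≤n)
... | zero with ∑-pos (f ∘ suc) pos
...   | i , fi>0 = suc i , fi>0

atMostOne : ∀ {n} {P : Fin n → Set} (P? : ∀ i → Dec (P i)) →
  (∀ i i′ → P i → P i′ → i ≡ i′) → ∑[ i < n ] count (P? i) ≤ 1
atMostOne {zero} _ _ = z≤n
atMostOne {suc n} {P} P? unique with P? zero
... | yes p₀ = ℕP.≤-reflexive (cong suc noOther)
  where
  noOther : ∑[ i < n ] count (P? (suc i)) ≡ 0
  noOther = trans (sum-cong-≗ (λ i → count-false (P? (suc i)) (0≢1+n ∘ unique zero (suc i) p₀)))
                  (sum-replicate-zero n)
... | no _ = atMostOne (P? ∘ suc) (λ i i′ p p′ → suc-injective (unique (suc i) (suc i′) p p′))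

injectiveCount : ∀ {n k} (f : Fin n → ℕ) (g : Fin k → ℕ)
  {R : Fin k → Fin n → Set} (R? : ∀ j i → Dec (R j i)) →
  (∀ i → f i ≤ 1) →
  (∀ i → 0 < f i → ∃ λ j → R j i × 0 < g j) →
  (∀ j i i′ → R j i → R j i′ → i ≡ i′) →
  ∑ f ≤ ∑ g
injectiveCount {n} {k} f g R? f≤1 covered functional = begin
  ∑ f                                             ≤⟨ ∑-mono pointwise ⟩
  ∑[ i < n ] ∑[ j < k ] (count (R? j i) * g j)    ≡⟨ ∑-comm (λ i j → count (R? j i) * g j) ⟩
  ∑[ j < k ] ∑[ i < n ] (count (R? j i) * g j)    ≡⟨ sum-cong-≗ (λ j → sym (*-distribʳ-sum (g j) (λ i → count (R? j i)))) ⟩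
  ∑[ j < k ] ((∑[ i < n ] count (R? j i)) * g j)  ≤⟨ ∑-mono (λ j → ℕP.*-monoˡ-≤ (g j) (atMostOne (R? j) (functional j))) ⟩
  ∑[ j < k ] (1 * g j)                            ≡⟨ sum-cong-≗ (λ j → ℕP.*-identityˡ (g j)) ⟩
  ∑ g                                             ∎
  where
  open ℕP.≤-Reasoning
  pointwise : ∀ i → f i ≤ ∑[ j < k ] (count (R? j i) * g j)
  pointwise i with f i | f≤1 i | covered i
  ... | zero | _ | _ = z≤n
  ... | suc _ | s≤s z≤n | cov with cov (s≤s z≤n)
  ...   | j , r , gj>0 = ℕP.≤-trans one≤term (term≤∑ (λ j′ → count (R? j′ i) * g j′) j)
    where
    one≤term : 1 ≤ count (R? j i) * g j
    one≤term = subst (λ c → 1 ≤ c * g j) (sym (count-true (R? j i) r))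
                     (subst (1 ≤_) (sym (ℕP.*-identityˡ (g j))) gj>0)

least : ∀ {P : ℕ → Set} → (∀ n → Dec (P n)) → ∀ n → P n →
  ∃ λ m → m ≤ n × P m × (∀ j → j < m → ¬ P j)
least P? zero p = zero , z≤n , p , λ _ ()
least {P} P? (suc n) p with P? zero
... | yes p₀ = zero , z≤n , p₀ , λ _ ()
... | no ¬p₀ with least {P ∘ suc} (P? ∘ suc) n p
...   | m , m≤n , pm , before = suc m , s≤s m≤n , pm , earlier
  where
  earlier : ∀ j → j < suc m → ¬ P j
  earlier zero _ = ¬p₀
  earlier (suc j) (s≤s j<m) = before j j<m

greatest : ∀ {P : ℕ → Set} → (∀ n → Dec (P n)) → P 0 → ∀ n →
  ∃ λ t → t ≤ n × P t × (∀ j → t < j → j ≤ n → ¬ P j)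
greatest P? p₀ zero = zero , z≤n , p₀ , λ j t<j j≤0 → ⊥-elim (ℕP.<⇒≱ t<j j≤0)
greatest {P} P? p₀ (suc n) with P? (suc n)
... | yes pn = suc n , ℕP.≤-refl , pn , λ j t<j j≤ → ⊥-elim (ℕP.<⇒≱ t<j j≤)
... | no ¬pn with greatest P? p₀ n
...   | t , t≤n , pt , after = t , ℕP.m≤n⇒m≤1+n t≤n , pt , later
  where
  later : ∀ j → t < j → j ≤ suc n → ¬ P j
  later j t<j j≤ with ℕP.m≤n⇒m<n∨m≡n j≤
  ... | inj₁ (s≤s j≤n) = after j t<j j≤n
  ... | inj₂ refl = ¬pn

m+suc[n∸suc-m]≡n : ∀ {m n} → m < n → m + suc (n ∸ suc m) ≡ n
m+suc[n∸suc-m]≡n {m} m<n = trans (ℕP.+-suc m _) (ℕP.m+[n∸m]≡n m<n)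

PlusMinusOne : (ℕ → ℤ) → Set
PlusMinusOne e = ∀ k → e k ≡ 1ℤ ⊎ e k ≡ -1ℤ

neg⇒≤-1 : ∀ {x} → x <ℤ 0ℤ → x ≤ℤ -1ℤ
neg⇒≤-1 { -[1+ _ ]} _ = -≤- z≤n
neg⇒≤-1 {+ _} (+<+ ())

neg⇒≤-2 : ∀ {x} → x <ℤ 0ℤ → x ≢ -1ℤ → x ≤ℤ -[1+ 1 ]
neg⇒≤-2 { -[1+ zero ]} _ x≢-1 = ⊥-elim (x≢-1 refl)
neg⇒≤-2 { -[1+ suc _ ]} _ _ = -≤- (s≤s z≤n)
neg⇒≤-2 {+ _} (+<+ ()) _

negative-step : ∀ {y} → y <ℤ 0ℤ → y ≡ 1ℤ ⊎ y ≡ -1ℤ → y ≡ -1ℤ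
negative-step (+<+ ()) (inj₁ refl)
negative-step _ (inj₂ y≡-1) = y≡-1

step-up : ∀ {x y} → x <ℤ 0ℤ → 0ℤ ≤ℤ x +ℤ y → y ≡ 1ℤ ⊎ y ≡ -1ℤ → y ≡ 1ℤ × x +ℤ y ≡ 0ℤ
step-up { -[1+ zero ]} _ _ (inj₁ refl) = refl , refl
step-up { -[1+ suc _ ]} _ () (inj₁ refl)
step-up { -[1+ _ ]} _ () (inj₂ refl)
step-up {+ _} (+<+ ()) _ _

-- Heights seen from a walk that started one step lower.
-1+y≤-2 : ∀ {y} → -1ℤ +ℤ y ≤ℤ -[1+ 1 ] → y <ℤ 0ℤ
-1+y≤-2 {+ zero} (-≤- ())
-1+y≤-2 {+ suc _} ()
-1+y≤-2 { -[1+ _ ]} _ = -<+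

-1+y≡-l-1 : ∀ {l y} → -1ℤ +ℤ y ≡ - (+ suc l) → y ≡ - (+ l)
-1+y≡-l-1 {zero} {+ zero} _ = refl
-1+y≡-l-1 {suc _} {+ zero} ()
-1+y≡-l-1 {_} {+ suc _} ()
-1+y≡-l-1 {suc _} { -[1+ _ ]} refl = refl

-l-1≤-1+y : ∀ {l y} → - (+ suc l) ≤ℤ -1ℤ +ℤ y → - (+ l) ≤ℤ y
-l-1≤-1+y {zero} {+ _} _ = +≤+ z≤n
-l-1≤-1+y {suc _} {+ _} _ = -≤+
-l-1≤-1+y {zero} { -[1+ _ ]} (-≤- ())
-l-1≤-1+y {suc _} { -[1+ _ ]} (-≤- (s≤s p)) = -≤- p

-1+y≡0 : ∀ {y} → -1ℤ +ℤ y ≡ 0ℤ → 0ℤ ≤ℤ y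
-1+y≡0 {+ _} _ = +≤+ z≤n
-1+y≡0 { -[1+ _ ]} ()

≤-1⇒-1+x≢-1 : ∀ {x} → x ≤ℤ -1ℤ → x +ℤ -1ℤ ≢ -1ℤ
≤-1⇒-1+x≢-1 { -[1+ _ ]} _ ()

psum-split : ∀ e x i j → psum e x (i + suc j) ≡ psum e x i +ℤ psum e (x + suc i) j
psum-split e x i zero = cong (psum e x) (trans (ℕP.+-suc i 0) (cong suc (ℕP.+-identityʳ i)))
psum-split e x i (suc j) = begin
  psum e x (i + suc (suc j))
    ≡⟨ cong (psum e x) (ℕP.+-suc i (suc j)) ⟩
  psum e x (i + suc j) +ℤ e (x + suc (i + suc j))
    ≡⟨ cong₂ _+ℤ_ (psum-split e x i j) (cong e (sym (ℕP.+-assoc x (suc i) (suc j)))) ⟩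
  (psum e x i +ℤ psum e (x + suc i) j) +ℤ e (x + suc i + suc j)
    ≡⟨ ℤP.+-assoc (psum e x i) _ _ ⟩
  psum e x i +ℤ psum e (x + suc i) (suc j) ∎
  where open ≡-Reasoning

psum-shift : ∀ e y x → (∀ k → e (y + k) ≡ e (x + k)) → ∀ i → psum e y i ≡ psum e x i
psum-shift e y x same zero = subst₂ (λ u v → e u ≡ e v) (ℕP.+-identityʳ y) (ℕP.+-identityʳ x) (same 0)
psum-shift e y x same (suc i) = cong₂ _+ℤ_ (psum-shift e y x same i) (same (suc i))

freeSeg-shift : ∀ l e y x m → (∀ k → e (y + k) ≡ e (x + k)) → IsFreeSeg l e x m → IsFreeSeg l e y m
freeSeg-shift l e y x m same (ex , em , ret , range , (i₁ , hit)) =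
  trans (psum-shift e y x same 0) ex ,
  trans (same m) em ,
  trans (psum-shift e y x same m) ret ,
  (λ i → subst (λ z → - (+ l) ≤ℤ z × z <ℤ 0ℤ) (sym (psum-shift e y x same (toℕ i))) (range i)) ,
  (i₁ , trans (psum-shift e y x same (toℕ i₁)) hit)

segment-range : ∀ {l e a m} → IsFreeSeg l e a m → ∀ i → i < m →
  - (+ l) ≤ℤ psum e a i × psum e a i <ℤ 0ℤ
segment-range {l} {e} {a} (_ , _ , _ , range , _) i i<m =
  subst (λ z → - (+ l) ≤ℤ psum e a z × psum e a z <ℤ 0ℤ) (toℕ-fromℕ< i<m) (range (fromℕ< i<m))

-- A free segment ends at the first return to 0, so its length is determined.
freeSeg-length-unique : ∀ {l l′ e a m m′} → IsFreeSeg l e a m → IsFreeSeg l′ e a m′ → m ≡ m′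
freeSeg-length-unique {m = m} {m′} seg seg′ with ℕP.<-cmp m m′
... | tri≈ _ m≡m′ _ = m≡m′
... | tri< m<m′ _ _ = ⊥-elim (ℤP.<-irrefl (proj₁ (proj₂ (proj₂ seg))) (proj₂ (segment-range seg′ m m<m′)))
... | tri> _ _ m′<m = ⊥-elim (ℤP.<-irrefl (proj₁ (proj₂ (proj₂ seg′))) (proj₂ (segment-range seg m′ m′<m)))

Anchor : (ℕ → ℤ) → ℕ → ℕ → Set
Anchor e A t = psum e A t ≡ -1ℤ × (∀ (j : Fin (suc t)) → psum e A (toℕ j) ≤ℤ -1ℤ)

anchor? : ∀ e A t → Dec (Anchor e A t)
anchor? e A t = (psum e A t ℤ.≟ -1ℤ) ×-dec all? (λ j → psum e A (toℕ j) ℤ.≤? -1ℤ)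

anchor-prefix : ∀ {e A t} → Anchor e A t → ∀ j → j ≤ t → psum e A j ≤ℤ -1ℤ
anchor-prefix {e} {A} (_ , below) j j≤t =
  subst (λ z → psum e A z ≤ℤ -1ℤ) (toℕ-fromℕ< (s≤s j≤t)) (below (fromℕ< (s≤s j≤t)))

-- If from time i+1 on the walk from A′ repeats the walk from A, then an anchor
-- of A at time t forces the walk from A′ to be at 0 at time i, so A′ has no
-- anchor at time i + 1 + t.
anchor-no-reentry : ∀ e A A′ i t → (∀ k → e (A′ + suc i + k) ≡ e (A + k)) →
  Anchor e A t → ¬ Anchor e A′ (i + suc t)
anchor-no-reentry e A A′ i t same (at-1 , _) anchor′@(at-1′ , _) =
  ≤-1⇒-1+x≢-1 (anchor-prefix anchor′ i (ℕP.m≤m+n i (suc t))) (begin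
    psum e A′ i +ℤ -1ℤ                        ≡⟨ cong (psum e A′ i +ℤ_) (sym (trans (psum-shift e (A′ + suc i) A same t) at-1)) ⟩
    psum e A′ i +ℤ psum e (A′ + suc i) t      ≡⟨ sym (psum-split e A′ i t) ⟩
    psum e A′ (i + suc t)                     ≡⟨ at-1′ ⟩
    -1ℤ                                       ∎)
  where open ≡-Reasoning

excursion : ∀ {e} l B w J → PlusMinusOne e →
  (∀ j → j ≤ w → psum e B j <ℤ 0ℤ) → psum e B w ≡ - (+ l) →
  (∀ j → j < J → - (+ l) ≤ℤ psum e B j) → 0ℤ ≤ℤ psum e B J →
  ∃ λ m → m ≤ J × IsFreeSeg l e B m
excursion {e} l B w J pm negative hit range nonneg-J
  with least (λ j → 0ℤ ℤ.≤? psum e B j) J nonneg-J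
... | zero , _ , nonneg₀ , _ = ⊥-elim (ℤP.<⇒≱ (negative 0 z≤n) nonneg₀)
... | suc p , m≤J , nonneg-m , notBefore = suc p , m≤J , segment
  where
  below : ∀ j → j ≤ p → psum e B j <ℤ 0ℤ
  below j j≤p = ℤP.≰⇒> (notBefore j (s≤s j≤p))
  w≤p : w ≤ p
  w≤p = ℕP.≮⇒≥ (λ p<w → ℤP.<⇒≱ (negative (suc p) p<w) nonneg-m)
  closes : e (B + suc p) ≡ 1ℤ × psum e B (suc p) ≡ 0ℤ
  closes = step-up (below p ℕP.≤-refl) nonneg-m (pm (B + suc p))
  segment : IsFreeSeg l e B (suc p)
  segment =
    negative-step (below 0 z≤n) (pm B) ,
    proj₁ closes , proj₂ closes ,
    (λ i → range (toℕ i) (ℕP.<-≤-trans (toℕ<n i) m≤J) , below (toℕ i) (ℕP.≤-pred (toℕ<n i))) ,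
    (fromℕ< (s≤s w≤p) , trans (cong (psum e B) (toℕ-fromℕ< (s≤s w≤p))) hit)

lastAnchor : ∀ {e A} I → e A ≡ -1ℤ → psum e A I ≢ -1ℤ → (∀ j → j ≤ I → psum e A j <ℤ 0ℤ) →
  ∃ λ t → t < I × Anchor e A t × (∀ j → t < j → j ≤ I → psum e A j ≤ℤ -[1+ 1 ])
lastAnchor {e} {A} I start notAt-1 negative
  with greatest (λ j → psum e A j ℤ.≟ -1ℤ) start I
... | t , t≤I , at-1 , after = t , t<I , anchor , deep
  where
  t<I : t < I
  t<I = ℕP.≤∧≢⇒< t≤I (λ t≡I → notAt-1 (subst (λ z → psum e A z ≡ -1ℤ) t≡I at-1))
  anchor : Anchor e A t
  anchor = at-1 , λ j → neg⇒≤-1 (negative (toℕ j) (ℕP.≤-trans (ℕP.≤-pred (toℕ<n j)) t≤I))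
  deep : ∀ j → t < j → j ≤ I → psum e A j ≤ℤ -[1+ 1 ]
  deep j t<j j≤I = neg⇒≤-2 (negative j j≤I) (after j t<j j≤I)

record Descent (k : ℕ) (e : ℕ → ℤ) (A m : ℕ) : Set where
  field
    t m′ : ℕ
    anchor : Anchor e A t
    child : IsFreeSeg (suc k) e (A + suc t) m′
    nested : t + suc m′ ≤ m

descend : ∀ {k e A m} → PlusMinusOne e → IsFreeSeg (2 + k) e A m → Descent k e A m
descend {k} {e} {A} {m} pm seg@(start , _ , ret , _ , (i₁ , bottom)) =
  fromAnchor (lastAnchor I start (λ at-1 → -1≢-[2+k] (trans (sym at-1) bottom))
                         (λ j j≤I → proj₂ (segment-range seg j (ℕP.≤-<-trans j≤I I<m))))
  where
  I : ℕ
  I = toℕ i₁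
  I<m : I < m
  I<m = toℕ<n i₁
  -1≢-[2+k] : -1ℤ ≢ -[1+ suc k ]
  -1≢-[2+k] ()
  fromAnchor : (∃ λ t → t < I × Anchor e A t × (∀ j → t < j → j ≤ I → psum e A j ≤ℤ -[1+ 1 ])) →
    Descent k e A m
  fromAnchor (t , t<I , anchor@(at-1 , _) , deep) =
    record { t = t ; m′ = proj₁ sub ; anchor = anchor ; child = proj₂ (proj₂ sub) ; nested = nested }
    where
    B J : ℕ
    B = A + suc t
    J = m ∸ suc t
    t<m : t < m
    t<m = ℕP.<-trans t<I I<m
    fromB : ∀ j → psum e A (t + suc j) ≡ -1ℤ +ℤ psum e B j
    fromB j = trans (psum-split e A t j) (cong (_+ℤ psum e B j) at-1)
    negative : ∀ j → j ≤ I ∸ suc t → psum e B j <ℤ 0ℤ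
    negative j j≤w = -1+y≤-2 (subst (_≤ℤ -[1+ 1 ]) (fromB j)
      (deep (t + suc j) (ℕP.m<m+n t (s≤s z≤n))
            (subst (t + suc j ≤_) (m+suc[n∸suc-m]≡n t<I) (ℕP.+-monoʳ-≤ t (s≤s j≤w)))))
    hit : psum e B (I ∸ suc t) ≡ - (+ suc k)
    hit = -1+y≡-l-1 (trans (sym (fromB _)) (trans (cong (psum e A) (m+suc[n∸suc-m]≡n t<I)) bottom))
    range : ∀ j → j < J → - (+ suc k) ≤ℤ psum e B j
    range j j<J = -l-1≤-1+y (subst (- (+ suc (suc k)) ≤ℤ_) (fromB j)
      (proj₁ (segment-range seg (t + suc j)
        (subst (t + suc j <_) (m+suc[n∸suc-m]≡n t<m) (ℕP.+-monoʳ-< t (s≤s j<J))))))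
    nonneg : 0ℤ ≤ℤ psum e B J
    nonneg = -1+y≡0 (trans (sym (fromB J)) (trans (cong (psum e A) (m+suc[n∸suc-m]≡n t<m)) ret))
    sub : ∃ λ m′ → m′ ≤ J × IsFreeSeg (suc k) e B m′
    sub = excursion (suc k) B (I ∸ suc t) J pm negative hit range nonneg
    nested : t + suc (proj₁ sub) ≤ m
    nested = subst (t + suc (proj₁ sub) ≤_) (m+suc[n∸suc-m]≡n t<m) (ℕP.+-monoʳ-≤ t (s≤s (proj₁ (proj₂ sub))))

toℕ-mod : ∀ x d .{{_ : NonZero d}} → toℕ (x mod d) ≡ x % d
toℕ-mod x d = toℕ-fromℕ< (m%n<n x d)

mod⇒% : ∀ {x y d} .{{_ : NonZero d}} → x mod d ≡ y mod d → x % d ≡ y % d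
mod⇒% {x} {y} {d} eq = trans (sym (toℕ-mod x d)) (trans (cong toℕ eq) (toℕ-mod y d))

%-congʳ-+ : ∀ {x y} k d .{{_ : NonZero d}} → x % d ≡ y % d → (x + k) % d ≡ (y + k) % d
%-congʳ-+ {x} {y} k d eq = begin
  (x + k) % d               ≡⟨ %-distribˡ-+ x k d ⟩
  (x % d + k % d) % d       ≡⟨ cong (λ r → (r + k % d) % d) eq ⟩
  (y % d + k % d) % d       ≡⟨ sym (%-distribˡ-+ y k d) ⟩
  (y + k) % d               ∎
  where open ≡-Reasoning

-- Adding c is invertible modulo d: x + c·d = (x + c) + c·(d - 1).
%-cancelʳ-+ : ∀ {x y} c d .{{_ : NonZero d}} → (x + c) % d ≡ (y + c) % d → x % d ≡ y % d
%-cancelʳ-+ {x} {y} c d eq = begin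
  x % d                         ≡⟨ sym ([m+kn]%n≡m%n x c d) ⟩
  (x + c * d) % d               ≡⟨ cong (_% d) (regroup x) ⟩
  (x + c + c * (d ∸ 1)) % d     ≡⟨ %-congʳ-+ (c * (d ∸ 1)) d eq ⟩
  (y + c + c * (d ∸ 1)) % d     ≡⟨ cong (_% d) (sym (regroup y)) ⟩
  (y + c * d) % d               ≡⟨ [m+kn]%n≡m%n y c d ⟩
  y % d                         ∎
  where
  open ≡-Reasoning
  regroup : ∀ z → z + c * d ≡ z + c + c * (d ∸ 1)
  regroup z = begin
    z + c * d                ≡⟨ cong (λ d′ → z + c * d′) (sym (ℕP.suc-pred d)) ⟩
    z + c * suc (d ∸ 1)      ≡⟨ cong (λ r → z + r) (ℕP.*-suc c (d ∸ 1)) ⟩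
    z + (c + c * (d ∸ 1))    ≡⟨ sym (ℕP.+-assoc z c _) ⟩
    z + c + c * (d ∸ 1)      ∎

module Circular (s : ℕ) .{{_ : NonZero s}} (ε : Fin s → ℤ) (pmε : IsPMOne ε) where

  e : ℕ → ℤ
  e = entry s ε

  pm : PlusMinusOne e
  pm k = pmε (k mod s)

  periodic : ∀ {x y} → x % s ≡ y % s → e x ≡ e y
  periodic {x} {y} eq = cong ε (toℕ-injective (trans (toℕ-mod x s) (trans eq (sym (toℕ-mod y s)))))

  segmentsAt : ℕ → Fin s → ℕ
  segmentsAt l a = ∑[ m < s ] count (isFreeSeg? l e (toℕ a) (toℕ m))

  segmentsAt≤1 : ∀ l a → segmentsAt l a ≤ 1
  segmentsAt≤1 l a = atMostOne {s} (λ m → isFreeSeg? l e (toℕ a) (toℕ m))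
    (λ m m′ seg seg′ → toℕ-injective (freeSeg-length-unique seg seg′))

  a≡∑segmentsAt : ∀ l → a[ l ] s ε ≡ ∑[ a < s ] segmentsAt l a
  a≡∑segmentsAt l = trans (listSum-allFin segmentsAtList) (sum-cong-≗ (λ a → listSum-allFin (counts a)))
    where
    counts : Fin s → Fin s → ℕ
    counts a m = count (isFreeSeg? l e (toℕ a) (toℕ m))
    segmentsAtList : Fin s → ℕ
    segmentsAtList a = List.sum (map (counts a) (allFin s))

  ChildOf : Fin s → Fin s → Set
  ChildOf b a = ∃ λ (t : Fin s) → b ≡ (toℕ a + suc (toℕ t)) mod s × Anchor e (toℕ a) (toℕ t)

  childOf? : ∀ b a → Dec (ChildOf b a)
  childOf? b a = any? (λ t → (b ≟ (toℕ a + suc (toℕ t)) mod s) ×-dec anchor? e (toℕ a) (toℕ t))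

  sameEnd⇒sameLength : ∀ A A′ T T′ → (A + suc T) % s ≡ (A′ + suc T′) % s → T < T′ →
    Anchor e A T → ¬ Anchor e A′ T′
  sameEnd⇒sameLength A A′ T T′ sameEnd T<T′ anchor anchor′ =
    anchor-no-reentry e A A′ i T repeats anchor (subst (Anchor e A′) (sym T′≡) anchor′)
    where
    i : ℕ
    i = T′ ∸ suc T
    T′≡ : i + suc T ≡ T′
    T′≡ = trans (ℕP.+-comm i (suc T)) (ℕP.m+[n∸m]≡n T<T′)
    repeats : ∀ k → e (A′ + suc i + k) ≡ e (A + k)
    repeats k = periodic (%-congʳ-+ k s (%-cancelʳ-+ (suc T) s (begin
      (A′ + suc i + suc T) % s   ≡⟨ cong (_% s) (trans (ℕP.+-assoc A′ (suc i) (suc T)) (cong (λ r → A′ + suc r) T′≡)) ⟩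
      (A′ + suc T′) % s          ≡⟨ sym sameEnd ⟩
      (A + suc T) % s            ∎)))
      where open ≡-Reasoning

  childOf-functional : ∀ b a a′ → ChildOf b a → ChildOf b a′ → a ≡ a′
  childOf-functional b a a′ (t , b≡ , anchor) (t′ , b≡′ , anchor′) with ℕP.<-cmp (toℕ t) (toℕ t′)
  ... | tri< t<t′ _ _ = ⊥-elim (sameEnd⇒sameLength _ _ _ _ (mod⇒% (trans (sym b≡) b≡′)) t<t′ anchor anchor′)
  ... | tri> _ _ t′<t = ⊥-elim (sameEnd⇒sameLength _ _ _ _ (mod⇒% (trans (sym b≡′) b≡)) t′<t anchor′ anchor)
  ... | tri≈ _ t≡t′ _ = toℕ-injective (begin
    toℕ a          ≡⟨ sym (m<n⇒m%n≡m (toℕ<n a)) ⟩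
    toℕ a % s      ≡⟨ %-cancelʳ-+ (suc (toℕ t)) s sameEnd ⟩
    toℕ a′ % s     ≡⟨ m<n⇒m%n≡m (toℕ<n a′) ⟩
    toℕ a′         ∎)
    where
    open ≡-Reasoning
    sameEnd : (toℕ a + suc (toℕ t)) % s ≡ (toℕ a′ + suc (toℕ t)) % s
    sameEnd = trans (mod⇒% (trans (sym b≡) b≡′)) (cong (λ r → (toℕ a′ + suc r) % s) (sym t≡t′))

  descentChild : ∀ k a (m : Fin s) → Descent k e (toℕ a) (toℕ m) →
    ∃ λ b → ChildOf b a × 0 < segmentsAt (1 + k) b
  descentChild k a m descent = b , (fromℕ< t<s , b≡ , anchor′) , childCounted
    where
    open Descent descent
    A B : ℕ
    A = toℕ a
    B = A + suc t
    b : Fin s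
    b = B mod s
    t+suc-m′<s : t + suc m′ < s
    t+suc-m′<s = ℕP.≤-<-trans nested (toℕ<n m)
    t<s : t < s
    t<s = ℕP.≤-<-trans (ℕP.m≤m+n t (suc m′)) t+suc-m′<s
    m′<s : m′ < s
    m′<s = ℕP.≤-<-trans (ℕP.≤-trans (ℕP.n≤1+n m′) (ℕP.m≤n+m (suc m′) t)) t+suc-m′<s
    b≡ : b ≡ (A + suc (toℕ (fromℕ< t<s))) mod s
    b≡ = cong (λ r → (A + suc r) mod s) (sym (toℕ-fromℕ< t<s))
    anchor′ : Anchor e A (toℕ (fromℕ< t<s))
    anchor′ = subst (Anchor e A) (sym (toℕ-fromℕ< t<s)) anchor
    fromB : ∀ j → e (toℕ b + j) ≡ e (B + j)
    fromB j = periodic (%-congʳ-+ j s (trans (cong (_% s) (toℕ-mod B s)) (m%n%n≡m%n B s)))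
    childAtb : IsFreeSeg (1 + k) e (toℕ b) (toℕ (fromℕ< m′<s))
    childAtb = subst (IsFreeSeg (1 + k) e (toℕ b)) (sym (toℕ-fromℕ< m′<s))
                     (freeSeg-shift (1 + k) e (toℕ b) B m′ fromB child)
    childCounted : 0 < segmentsAt (1 + k) b
    childCounted = ℕP.≤-trans (ℕP.≤-reflexive (sym (count-true (isFreeSeg? (1 + k) e (toℕ b) (toℕ (fromℕ< m′<s))) childAtb)))
                              (term≤∑ (λ m → count (isFreeSeg? (1 + k) e (toℕ b) (toℕ m))) (fromℕ< m′<s))

  childSegment : ∀ k a → 0 < segmentsAt (2 + k) a → ∃ λ b → ChildOf b a × 0 < segmentsAt (1 + k) b
  childSegment k a pos with ∑-pos (λ m → count (isFreeSeg? (2 + k) e (toℕ a) (toℕ m))) pos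
  ... | m , m-counted =
    descentChild k a m (descend pm (count-pos (isFreeSeg? (2 + k) e (toℕ a) (toℕ m)) m-counted))

  levelDecreases : ∀ k → a[ 2 + k ] s ε ≤ a[ 1 + k ] s ε
  levelDecreases k = begin
    a[ 2 + k ] s ε                  ≡⟨ a≡∑segmentsAt (2 + k) ⟩
    ∑[ a < s ] segmentsAt (2 + k) a  ≤⟨ injectiveCount (segmentsAt (2 + k)) (segmentsAt (1 + k)) childOf?
                                         (segmentsAt≤1 (2 + k)) (childSegment k) childOf-functional ⟩
    ∑[ b < s ] segmentsAt (1 + k) b  ≡⟨ sym (a≡∑segmentsAt (1 + k)) ⟩
    a[ 1 + k ] s ε                  ∎
    where open ℕP.≤-Reasoning

corollary4p8 : (s : ℕ) .{{_ : NonZero s}} (ε : Fin s → ℤ) → IsPMOne ε →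
    (l : ℕ) → 2 ≤ l → a[ l ] s ε ≤ a[ l ∸ 1 ] s ε
corollary4p8 s ε pm (suc (suc k)) _ = Circular.levelDecreases s ε pm k
corollary4p8 s ε pm (suc zero) (s≤s ())
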